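{- Let $r\ge3$ and let the $r$-pattern $P$ be a big brother. Then every $P$-family-clique of size $k$ contains a $P$-clique of size at least $k/2$.
   Context: An $r$-pattern is an ordered $r$-matching with two edges, up to order-isomorphism, written as a word of length $2r$ in letters $A,B$ each occurring $r$ times. For an $r$-pattern $P$ ($r\ge3$), $\mathrm{dec}(P)=(Q,R)$ where $Q$ is the $(r-1)$-pattern obtained by deleting the last $A$ and last $B$ of $P$, and $R$ is the $2$-pattern formed by the last two $A$'s and last two $B$'s of $P$. Two edges of a matching form pattern $P$ if with the induced order they are order-isomorphic to $P$. A $P$-clique is a matching in which every pair of edges forms $P$; $P$ is collectable if $P$-cliques of every size $k\ge2$ exist. A big brother is a collectable $r$-pattern $P$ such that there is at least one other $r$-pattern $P'\ne P$ with $\mathrm{dec}(P')=\mathrm{dec}(P)$. The $P$-family of a big brother $P$ is the set of all $r$-patterns $P'$ with $\mathrm{dec}(P')=\mathrm{dec}(P)$. A $P$-family-clique is an ordered $r$-matching in which every pair of edges forms a pattern belonging to the $P$-family. -}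

module Defs where

open import Data.Nat using (ℕ; zero; suc; _≤_; _*_; _<_)
open import Data.Bool using (Bool; true; false; if_then_else_)
open import Data.List using (List; []; _∷_; length; filter; map; reverse)
open import Data.Fin using (Fin)
open import Data.Fin.Properties using () renaming (_≟_ to _≟F_)
open import Data.Fin.Subset using (Subset; _∈_; ∣_∣)
open import Data.Product using (Σ; _×_; _,_; ∃)
open import Relation.Binary.PropositionalEquality using (_≡_; _≢_)
open import Relation.Nullary using (Dec; yes; no; does)

data AB : Set where
  A B : AB

_≟AB_ : (x y : AB) → Dec (x ≡ y)
A ≟AB A = yes _≡_.refl
A ≟AB B = no (λ ())
B ≟AB A = no (λ ())
B ≟AB B = yes _≡_.refl

countAB : AB → List AB → ℕ
countAB x w = length (filter (x ≟AB_) w)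

swap : AB → AB
swap A = B
swap B = A

-- Normal form of a two-edge word up to order-isomorphism (renaming the
-- edges): the first letter is made to be A.
normalize : List AB → List AB
normalize [] = []
normalize (A ∷ w) = A ∷ w
normalize (B ∷ w) = map swap (B ∷ w)

record IsPattern (r : ℕ) (P : List AB) : Set where
  field
    countA : countAB A P ≡ r
    countB : countAB B P ≡ r
    normal : normalize P ≡ P

deleteFirst : AB → List AB → List AB
deleteFirst x [] = []
deleteFirst x (y ∷ w) = if does (x ≟AB y) then w else y ∷ deleteFirst x w

deleteLast : AB → List AB → List AB
deleteLast x w = reverse (deleteFirst x (reverse w))

keepTwo : ℕ → ℕ → List AB → List AB
keepTwo a b [] = []
keepTwo a b (A ∷ w) with a
... | suc (suc _) = keepTwo a b w
... | _ = A ∷ keepTwo (suc a) b w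
keepTwo a b (B ∷ w) with b
... | suc (suc _) = keepTwo a b w
... | _ = B ∷ keepTwo a (suc b) w

lastTwo : List AB → List AB
lastTwo w = reverse (keepTwo 0 0 (reverse w))

dec : List AB → List AB × List AB
dec P = normalize (deleteLast B (deleteLast A P)) , normalize (lastTwo P)

-- Ordered r-matchings with k edges: the vertices are linearly ordered
-- (positions in a list), each vertex is labelled by the edge (Fin k)
-- containing it, and every edge contains exactly r vertices.

occ : {k : ℕ} → Fin k → List (Fin k) → ℕ
occ i w = length (filter (_≟F i) w)

record Matching (r k : ℕ) : Set where
  field
    word    : List (Fin k)
    uniform : ∀ i → occ i word ≡ r
open Matching public

formWord : {k : ℕ} → Fin k → Fin k → List (Fin k) → List AB
formWord i j [] = []
formWord i j (x ∷ w) with x ≟F i | x ≟F j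
... | yes _ | _     = A ∷ formWord i j w
... | no _  | yes _ = B ∷ formWord i j w
... | no _  | no _  = formWord i j w

form : {r k : ℕ} → Matching r k → Fin k → Fin k → List AB
form M i j = normalize (formWord i j (word M))

IsClique : {r k : ℕ} → List AB → Matching r k → Set
IsClique P M = ∀ i j → i ≢ j → form M i j ≡ P

Collectable : ℕ → List AB → Set
Collectable r P = ∀ k → 2 ≤ k → Σ (Matching r k) (IsClique P)

record BigBrother (r : ℕ) (P : List AB) : Set where
  field
    isPattern   : IsPattern r P
    collectable : Collectable r P
    brother     : ∃ λ P' → IsPattern r P' × P' ≢ P × dec P' ≡ dec P

InFamily : ℕ → List AB → List AB → Set
InFamily r P Q = IsPattern r Q × dec Q ≡ dec P

IsFamilyClique : {r k : ℕ} → List AB → Matching r k → Set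
IsFamilyClique {r} P M = ∀ i j → i ≢ j → InFamily r P (form M i j)

IsCliqueOn : {r k : ℕ} → List AB → Matching r k → Subset k → Set
IsCliqueOn P M S = ∀ i j → i ∈ S → j ∈ S → i ≢ j → form M i j ≡ P

{-# OPTIONS --safe #-}
-- Read patterns from the right: mirror W = normalize (reverse W). The mirror of an r-pattern
-- has the shape A A^j B A^u B τ, and dec only sees A^(j+u) B τ together with whether the mirror
-- starts with AA, ABA or ABB. Hence a pattern with j = 0 is alone in its family, so the mirror of
-- a big brother P is A A^(j+1) B A^u B τ, and the family of P consists of the patterns with
-- mirror A A^(j′+1) B A^u′ B τ, j′ + u′ = j + u.
--
-- Number the vertices from the right and write x ◃ y when the last vertex of edge x lies to the
-- right of that of y. In a family-clique, for x ◃ y the second vertex of x comes before the first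
-- vertex of y, and the (j+u+2)-nd vertex of x before the second vertex of y; if u′ ≥ 1 it also
-- comes after the first vertex of y, i.e. it lies in the first gap of y. First gaps of distinct
-- edges are disjoint, so x lies in the first gap of at most one later edge. In a P-clique on three
-- edges the ◃-least one would lie in two, so collectability of P forces u = 0. Then every pair
-- that does not form P has u′ ≥ 1, so in the graph of such pairs each edge has at most one
-- ◃-later neighbour; this graph is 2-colourable and the larger colour class is a P-clique with at
-- least k/2 edges.
module Submission where

open import Defs
open import Data.Nat using (ℕ; zero; suc; _+_; _*_; _⊔_; _≤_; _<_; z≤n; s≤s; _≟_; _<?_)
open import Data.Nat.Properties
open import Data.Bool using (Bool; true; false; not)
open import Data.Fin using (Fin; zero; suc)
open import Data.Fin.Properties using (any?) renaming (_≟_ to _≟F_)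
open import Data.Bool.Properties using (not-¬; not-injective)
open import Data.List using (List; []; _∷_; length; filter; map; reverse; replicate; _++_; [_])
open import Data.List.Properties
  using (∷-injectiveʳ; ≡-dec; reverse-involutive; reverse-map; reverse-++; unfold-reverse; length-++; length-++-comm; filter-++)
open import Data.Fin.Subset using (Subset; _∈_; ∁; ∣_∣)
open import Data.Fin.Subset.Properties using (∣p∣≤n; ∣∁p∣≡n∸∣p∣)
open import Data.Vec using (tabulate)
open import Data.Vec.Properties using (lookup∘tabulate; []=⇒lookup; tabulate-∘)
open import Data.Product using (Σ; _×_; _,_; ∃; ∃₂; proj₁; proj₂)
open import Relation.Binary.PropositionalEquality hiding ([_])
open import Relation.Nullary using (¬_; Dec; yes; no)
open import Relation.Nullary.Decidable using (_×-dec_; ¬?; decidable-stable)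
open import Relation.Unary using (Pred; Decidable)
open import Data.Empty using (⊥; ⊥-elim)
open import Data.Sum using (_⊎_; inj₁; inj₂)
open import Function using (_∘′_)

swapAll : List AB → List AB
swapAll = map swap

swap-involutive : ∀ x → swap (swap x) ≡ x
swap-involutive A = refl
swap-involutive B = refl

swapAll-involutive : ∀ z → swapAll (swapAll z) ≡ z
swapAll-involutive []      = refl
swapAll-involutive (x ∷ z) = cong₂ _∷_ (swap-involutive x) (swapAll-involutive z)

normalize-cases : ∀ z → normalize z ≡ z ⊎ normalize z ≡ swapAll z
normalize-cases []      = inj₁ refl
normalize-cases (A ∷ z) = inj₁ refl
normalize-cases (B ∷ z) = inj₂ refl

normalize-swapAll : ∀ z → normalize (swapAll z) ≡ normalize z
normalize-swapAll []      = refl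
normalize-swapAll (A ∷ z) = cong (A ∷_) (swapAll-involutive z)
normalize-swapAll (B ∷ z) = refl

normalize-∷-injective : ∀ x {z₁ z₂} → normalize (x ∷ z₁) ≡ normalize (x ∷ z₂) → z₁ ≡ z₂
normalize-∷-injective A e = ∷-injectiveʳ e
normalize-∷-injective B {z₁} {z₂} e = begin
  z₁                     ≡⟨ swapAll-involutive z₁ ⟨
  swapAll (swapAll z₁)   ≡⟨ cong swapAll (∷-injectiveʳ e) ⟩
  swapAll (swapAll z₂)   ≡⟨ swapAll-involutive z₂ ⟩
  z₂                     ∎
  where open ≡-Reasoning

mirror : List AB → List AB
mirror z = normalize (reverse z)

mirror-swapAll : ∀ z → mirror (swapAll z) ≡ mirror z
mirror-swapAll z = trans (cong normalize (sym (reverse-map swap z))) (normalize-swapAll (reverse z))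

mirror-normalize : ∀ z → mirror (normalize z) ≡ mirror z
mirror-normalize z with normalize-cases z
... | inj₁ e = cong mirror e
... | inj₂ e = trans (cong mirror e) (mirror-swapAll z)

mirror-mirror : ∀ z → mirror (mirror z) ≡ normalize z
mirror-mirror z = trans (mirror-normalize (reverse z)) (cong normalize (reverse-involutive z))

mirror-injective : ∀ z₁ z₂ → mirror z₁ ≡ mirror z₂ → normalize z₁ ≡ normalize z₂
mirror-injective z₁ z₂ e = trans (sym (mirror-mirror z₁)) (trans (cong mirror e) (mirror-mirror z₂))

mirror-injective-on-patterns : ∀ {r} {W₁ W₂ : List AB} → IsPattern r W₁ → IsPattern r W₂ → mirror W₁ ≡ mirror W₂ → W₁ ≡ W₂
mirror-injective-on-patterns {W₁ = W₁} {W₂} p₁ p₂ e =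
  trans (sym (IsPattern.normal p₁)) (trans (mirror-injective W₁ W₂ e) (IsPattern.normal p₂))

decFront : List AB → List AB × List AB
decFront v = mirror (deleteFirst B (deleteFirst A v)) , mirror (keepTwo 0 0 v)

dec-reverse : ∀ W → dec W ≡ decFront (reverse W)
dec-reverse W = cong (λ z → normalize (reverse (deleteFirst B z)) , normalize (lastTwo W))
                     (reverse-involutive (deleteFirst A (reverse W)))

deleteFirst-swapAll : ∀ x v → deleteFirst x (swapAll v) ≡ swapAll (deleteFirst (swap x) v)
deleteFirst-swapAll x []      = refl
deleteFirst-swapAll A (A ∷ v) = cong (B ∷_) (deleteFirst-swapAll A v)
deleteFirst-swapAll A (B ∷ v) = refl
deleteFirst-swapAll B (A ∷ v) = refl
deleteFirst-swapAll B (B ∷ v) = cong (A ∷_) (deleteFirst-swapAll B v)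

deleteFirst-comm : ∀ v → deleteFirst A (deleteFirst B v) ≡ deleteFirst B (deleteFirst A v)
deleteFirst-comm []      = refl
deleteFirst-comm (A ∷ v) = refl
deleteFirst-comm (B ∷ v) = refl

keepTwo-swapAll : ∀ a b v → keepTwo a b (swapAll v) ≡ swapAll (keepTwo b a v)
keepTwo-swapAll a b []      = refl
keepTwo-swapAll a b (A ∷ v) with b
... | zero         = cong (B ∷_) (keepTwo-swapAll a 1 v)
... | suc zero     = cong (B ∷_) (keepTwo-swapAll a 2 v)
... | suc (suc b′) = keepTwo-swapAll a (suc (suc b′)) v
keepTwo-swapAll a b (B ∷ v) with a
... | zero         = cong (A ∷_) (keepTwo-swapAll 1 b v)
... | suc zero     = cong (A ∷_) (keepTwo-swapAll 2 b v)
... | suc (suc a′) = keepTwo-swapAll (suc (suc a′)) b v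

decFront-swapAll : ∀ v → decFront (swapAll v) ≡ decFront v
decFront-swapAll v = cong₂ _,_ deleted kept
  where
  open ≡-Reasoning
  deleted : mirror (deleteFirst B (deleteFirst A (swapAll v))) ≡ mirror (deleteFirst B (deleteFirst A v))
  deleted = begin
    mirror (deleteFirst B (deleteFirst A (swapAll v)))   ≡⟨ cong (mirror ∘′ deleteFirst B) (deleteFirst-swapAll A v) ⟩
    mirror (deleteFirst B (swapAll (deleteFirst B v)))   ≡⟨ cong mirror (deleteFirst-swapAll B (deleteFirst B v)) ⟩
    mirror (swapAll (deleteFirst A (deleteFirst B v)))   ≡⟨ mirror-swapAll (deleteFirst A (deleteFirst B v)) ⟩
    mirror (deleteFirst A (deleteFirst B v))             ≡⟨ cong mirror (deleteFirst-comm v) ⟩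
    mirror (deleteFirst B (deleteFirst A v))             ∎
  kept : mirror (keepTwo 0 0 (swapAll v)) ≡ mirror (keepTwo 0 0 v)
  kept = trans (cong mirror (keepTwo-swapAll 0 0 v)) (mirror-swapAll (keepTwo 0 0 v))

decFront-normalize : ∀ v → decFront (normalize v) ≡ decFront v
decFront-normalize v with normalize-cases v
... | inj₁ e = cong decFront e
... | inj₂ e = trans (cong decFront e) (decFront-swapAll v)

dec-mirror : ∀ W → dec W ≡ decFront (mirror W)
dec-mirror W = trans (dec-reverse W) (sym (decFront-normalize (reverse W)))

length-filter-reverse : ∀ {a p} {X : Set a} {P : Pred X p} (P? : Decidable P) xs →
                        length (filter P? (reverse xs)) ≡ length (filter P? xs)
length-filter-reverse P? []       = refl
length-filter-reverse P? (x ∷ xs) = begin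
  length (filter P? (reverse (x ∷ xs)))                 ≡⟨ cong (length ∘′ filter P?) (unfold-reverse x xs) ⟩
  length (filter P? (reverse xs ++ [ x ]))              ≡⟨ cong length (filter-++ P? (reverse xs) [ x ]) ⟩
  length (filter P? (reverse xs) ++ filter P? [ x ])    ≡⟨ length-++-comm (filter P? (reverse xs)) _ ⟩
  length (filter P? [ x ] ++ filter P? (reverse xs))    ≡⟨ length-++ (filter P? [ x ]) ⟩
  length (filter P? [ x ]) + length (filter P? (reverse xs))
                                                        ≡⟨ cong (length (filter P? [ x ]) +_) (length-filter-reverse P? xs) ⟩
  length (filter P? [ x ]) + length (filter P? xs)      ≡⟨ length-++ (filter P? [ x ]) ⟨
  length (filter P? [ x ] ++ filter P? xs)              ≡⟨ cong length (filter-++ P? [ x ] xs) ⟨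
  length (filter P? (x ∷ xs))                           ∎
  where open ≡-Reasoning

countAB-swapAll : ∀ x z → countAB x (swapAll z) ≡ countAB (swap x) z
countAB-swapAll x []      = refl
countAB-swapAll A (A ∷ z) = countAB-swapAll A z
countAB-swapAll A (B ∷ z) = cong suc (countAB-swapAll A z)
countAB-swapAll B (A ∷ z) = cong suc (countAB-swapAll B z)
countAB-swapAll B (B ∷ z) = countAB-swapAll B z

countAB-pattern : ∀ {r W} → IsPattern r W → ∀ x → countAB x W ≡ r
countAB-pattern pat A = IsPattern.countA pat
countAB-pattern pat B = IsPattern.countB pat

countAB-mirror : ∀ {r W} → IsPattern r W → ∀ x → countAB x (mirror W) ≡ r
countAB-mirror {r} {W} pat x with normalize-cases (reverse W)
... | inj₁ e = begin
  countAB x (mirror W)             ≡⟨ cong (countAB x) e ⟩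
  countAB x (reverse W)            ≡⟨ length-filter-reverse (x ≟AB_) W ⟩
  countAB x W                      ≡⟨ countAB-pattern pat x ⟩
  r                                ∎
  where open ≡-Reasoning
... | inj₂ e = begin
  countAB x (mirror W)             ≡⟨ cong (countAB x) e ⟩
  countAB x (swapAll (reverse W))  ≡⟨ countAB-swapAll x (reverse W) ⟩
  countAB (swap x) (reverse W)     ≡⟨ length-filter-reverse (swap x ≟AB_) W ⟩
  countAB (swap x) W               ≡⟨ countAB-pattern pat (swap x) ⟩
  r                                ∎
  where open ≡-Reasoning

shape : ℕ → ℕ → List AB → List AB
shape j u τ = A ∷ replicate j A ++ B ∷ replicate u A ++ B ∷ τ

countAB-A-replicate : ∀ j z → countAB A (replicate j A ++ z) ≡ j + countAB A z
countAB-A-replicate zero    z = refl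
countAB-A-replicate (suc j) z = cong suc (countAB-A-replicate j z)

countAB-A-shape : ∀ j u τ → countAB A (shape j u τ) ≡ suc (j + (u + countAB A τ))
countAB-A-shape j u τ = cong suc (trans (countAB-A-replicate j _) (cong (j +_) (countAB-A-replicate u _)))

split-at-B : ∀ z → 1 ≤ countAB B z →
             ∃₂ λ j z′ → z ≡ replicate j A ++ B ∷ z′ × countAB B z ≡ suc (countAB B z′)
split-at-B (A ∷ z) h with split-at-B z h
... | j , z′ , refl , c = suc j , z′ , refl , c
split-at-B (B ∷ z) _ = 0 , z , refl , refl

shape-of : ∀ s → 2 ≤ countAB B s → ∃₂ λ j u → ∃ λ τ → A ∷ s ≡ shape j u τ
shape-of s h with split-at-B s (≤-trans (s≤s z≤n) h)
... | j , s′ , refl , c with split-at-B s′ (≤-pred (subst (2 ≤_) c h))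
...   | u , τ , refl , _ = j , u , τ , refl

normalize-shape : ∀ v → 2 ≤ countAB B (normalize v) → ∃₂ λ j u → ∃ λ τ → normalize v ≡ shape j u τ
normalize-shape (A ∷ v) h = shape-of v h
normalize-shape (B ∷ v) h = shape-of (swapAll v) h

mirror-shape : ∀ {r W} → 2 ≤ r → IsPattern r W → ∃₂ λ j u → ∃ λ τ → mirror W ≡ shape j u τ
mirror-shape {W = W} 2≤r pat = normalize-shape (reverse W) (subst (2 ≤_) (sym (countAB-mirror pat B)) 2≤r)

replicate-A-++ : ∀ j u z → replicate j A ++ replicate u A ++ z ≡ replicate (j + u) A ++ z
replicate-A-++ zero    u z = refl
replicate-A-++ (suc j) u z = cong (A ∷_) (replicate-A-++ j u z)

deleteFirst-B-replicate : ∀ j z → deleteFirst B (replicate j A ++ B ∷ z) ≡ replicate j A ++ z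
deleteFirst-B-replicate zero    z = refl
deleteFirst-B-replicate (suc j) z = cong (A ∷_) (deleteFirst-B-replicate j z)

deleteFront-shape : ∀ j u τ → deleteFirst B (deleteFirst A (shape j u τ)) ≡ replicate (j + u) A ++ B ∷ τ
deleteFront-shape j u τ = trans (deleteFirst-B-replicate j _) (replicate-A-++ j u (B ∷ τ))

replicate-A-B∷-injective : ∀ n₁ n₂ {τ₁ τ₂} → replicate n₁ A ++ B ∷ τ₁ ≡ replicate n₂ A ++ B ∷ τ₂ →
                           n₁ ≡ n₂ × τ₁ ≡ τ₂
replicate-A-B∷-injective zero     zero     refl = refl , refl
replicate-A-B∷-injective (suc n₁) (suc n₂) e with replicate-A-B∷-injective n₁ n₂ (∷-injectiveʳ e)
... | refl , τ₁≡τ₂ = refl , τ₁≡τ₂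

-- keepTwo 0 0 (shape j u τ) starts with AA, ABA or ABB according as j > 0, j = 0 < u or j = u = 0.
decFront-shape-≡ : ∀ j₁ u₁ τ₁ j₂ u₂ τ₂ → decFront (shape j₁ u₁ τ₁) ≡ decFront (shape j₂ u₂ τ₂) →
  normalize (replicate (j₁ + u₁) A ++ B ∷ τ₁) ≡ normalize (replicate (j₂ + u₂) A ++ B ∷ τ₂) ×
  keepTwo 0 0 (shape j₁ u₁ τ₁) ≡ keepTwo 0 0 (shape j₂ u₂ τ₂)
decFront-shape-≡ j₁ u₁ τ₁ j₂ u₂ τ₂ e =
  mirror-injective (replicate (j₁ + u₁) A ++ B ∷ τ₁) (replicate (j₂ + u₂) A ++ B ∷ τ₂) deleted ,
  mirror-injective (keepTwo 0 0 (shape j₁ u₁ τ₁)) (keepTwo 0 0 (shape j₂ u₂ τ₂)) (cong proj₂ e)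
  where
  open ≡-Reasoning
  deleted : mirror (replicate (j₁ + u₁) A ++ B ∷ τ₁) ≡ mirror (replicate (j₂ + u₂) A ++ B ∷ τ₂)
  deleted = begin
    mirror (replicate (j₁ + u₁) A ++ B ∷ τ₁)                ≡⟨ cong mirror (deleteFront-shape j₁ u₁ τ₁) ⟨
    mirror (deleteFirst B (deleteFirst A (shape j₁ u₁ τ₁))) ≡⟨ cong proj₁ e ⟩
    mirror (deleteFirst B (deleteFirst A (shape j₂ u₂ τ₂))) ≡⟨ cong mirror (deleteFront-shape j₂ u₂ τ₂) ⟩
    mirror (replicate (j₂ + u₂) A ++ B ∷ τ₂)                ∎

decFront-shape-suc : ∀ j u τ j′ u′ τ′ → decFront (shape j u τ) ≡ decFront (shape (suc j′) u′ τ′) →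
                     ∃ λ j″ → j ≡ suc j″ × j″ + u ≡ j′ + u′ × τ ≡ τ′
decFront-shape-suc zero u τ j′ u′ τ′ e with proj₂ (decFront-shape-≡ 0 u τ (suc j′) u′ τ′ e)
... | ()
decFront-shape-suc (suc j) u τ j′ u′ τ′ e
  with replicate-A-B∷-injective (j + u) (j′ + u′)
         (normalize-∷-injective A (proj₁ (decFront-shape-≡ (suc j) u τ (suc j′) u′ τ′ e)))
... | j+u≡j′+u′ , τ≡τ′ = j , refl , j+u≡j′+u′ , τ≡τ′

decFront-shape-zero : ∀ j u τ u′ τ′ → decFront (shape j u τ) ≡ decFront (shape 0 u′ τ′) →
                      shape j u τ ≡ shape 0 u′ τ′
decFront-shape-zero (suc j) u τ u′ τ′ e with proj₂ (decFront-shape-≡ (suc j) u τ 0 u′ τ′ e)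
... | ()
decFront-shape-zero zero zero τ (suc u′) τ′ e with proj₂ (decFront-shape-≡ 0 0 τ 0 (suc u′) τ′ e)
... | ()
decFront-shape-zero zero (suc u) τ zero τ′ e with proj₂ (decFront-shape-≡ 0 (suc u) τ 0 0 τ′ e)
... | ()
decFront-shape-zero zero zero τ zero τ′ e =
  cong (shape 0 0) (normalize-∷-injective B (proj₁ (decFront-shape-≡ 0 0 τ 0 0 τ′ e)))
decFront-shape-zero zero (suc u) τ (suc u′) τ′ e
  with replicate-A-B∷-injective u u′ (normalize-∷-injective A (proj₁ (decFront-shape-≡ 0 (suc u) τ 0 (suc u′) τ′ e)))
... | refl , refl = refl

dec-via-shape : ∀ W {s} → mirror W ≡ s → dec W ≡ decFront s
dec-via-shape W e = trans (dec-mirror W) (cong decFront e)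

family-of-shape-zero : ∀ {r W W′ u τ} → 2 ≤ r → IsPattern r W → IsPattern r W′ →
                       mirror W ≡ shape 0 u τ → dec W′ ≡ dec W → W′ ≡ W
family-of-shape-zero {W = W} {W′} {u} {τ} 2≤r pat pat′ e same with mirror-shape 2≤r pat′
... | j′ , u′ , τ′ , e′ = mirror-injective-on-patterns pat′ pat (begin
  mirror W′          ≡⟨ e′ ⟩
  shape j′ u′ τ′     ≡⟨ decFront-shape-zero j′ u′ τ′ u τ (trans (sym (dec-via-shape W′ e′)) (trans same (dec-via-shape W e))) ⟩
  shape 0 u τ        ≡⟨ e ⟨
  mirror W           ∎)
  where open ≡-Reasoning

bigBrother-mirror-shape : ∀ {r P} → 2 ≤ r → BigBrother r P → ∃₂ λ j u → ∃ λ τ → mirror P ≡ shape (suc j) u τ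
bigBrother-mirror-shape 2≤r bb with mirror-shape 2≤r (BigBrother.isPattern bb) | BigBrother.brother bb
... | suc j , u , τ , e | _ = j , u , τ , e
... | zero  , u , τ , e | _ , pat′ , P′≢P , same =
  ⊥-elim (P′≢P (family-of-shape-zero 2≤r (BigBrother.isPattern bb) pat′ e same))

MirrorFamily : ℕ → List AB → List AB → Set
MirrorFamily m τ W = ∃₂ λ j u → j + u ≡ m × mirror W ≡ shape (suc j) u τ

family-mirror-shape : ∀ {r P W j u τ} → 2 ≤ r → mirror P ≡ shape (suc j) u τ → InFamily r P W →
                      MirrorFamily (j + u) τ W
family-mirror-shape {P = P} {W} {j} {u} {τ} 2≤r e (pat , same) with mirror-shape 2≤r pat
... | j₀ , u₀ , τ₀ , e₀
  with decFront-shape-suc j₀ u₀ τ₀ j u τ (trans (sym (dec-via-shape W e₀)) (trans same (dec-via-shape P e)))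
... | j″ , refl , j″+u₀≡j+u , refl = j″ , u₀ , j″+u₀≡j+u , e₀

precedes : List AB → ℕ → ℕ → Bool
precedes []      p       q       = false
precedes (A ∷ z) zero    q       = true
precedes (A ∷ z) (suc p) q       = precedes z p q
precedes (B ∷ z) p       zero    = false
precedes (B ∷ z) p       (suc q) = precedes z p q

precedes-replicate-skip : ∀ m z p q → precedes (replicate m A ++ z) (m + p) q ≡ precedes z p q
precedes-replicate-skip zero    z p q = refl
precedes-replicate-skip (suc m) z p q = precedes-replicate-skip m z p q

precedes-replicate-hit : ∀ m z p q → p < m → precedes (replicate m A ++ z) p q ≡ true
precedes-replicate-hit (suc m) z zero    q _   = refl
precedes-replicate-hit (suc m) z (suc p) q p<m = precedes-replicate-hit m z p q (≤-pred p<m)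

precedes-shape-last : ∀ j u τ → precedes (shape j u τ) (j + u) 1 ≡ true
precedes-shape-last j zero    τ = precedes-replicate-hit (suc j) _ (j + 0) 1 (s≤s (≤-reflexive (+-identityʳ j)))
precedes-shape-last j (suc u) τ rewrite +-suc j u =
  trans (precedes-replicate-skip (suc j) _ u 1) (precedes-replicate-hit (suc u) _ u 0 ≤-refl)

precedes-shape-gap : ∀ j u τ → precedes (shape j (suc u) τ) (j + suc u) 0 ≡ false
precedes-shape-gap j u τ rewrite +-suc j u = precedes-replicate-skip (suc j) _ u 0

position : ∀ {k} → List (Fin k) → Fin k → ℕ → ℕ
position []      i p = 0
position (x ∷ w) i p with x ≟F i | p
... | yes _ | zero   = 0
... | yes _ | suc p′ = suc (position w i p′)
... | no _  | _      = suc (position w i p)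

Ordered : Bool → ℕ → ℕ → Set
Ordered true  m n = m < n
Ordered false m n = n < m

Ordered-suc : ∀ b {m n} → Ordered b m n → Ordered b (suc m) (suc n)
Ordered-suc true  = s≤s
Ordered-suc false = s≤s

precedes-position : ∀ {k} (i j : Fin k) → i ≢ j → ∀ w p q → p < occ i w → q < occ j w →
                    Ordered (precedes (formWord i j w) p q) (position w i p) (position w j q)
precedes-position i j i≢j (x ∷ w) p q p< q< with x ≟F i | x ≟F j
... | yes refl | yes refl = ⊥-elim (i≢j refl)
... | yes refl | no _ with p
...   | zero   = s≤s z≤n
...   | suc p′ = Ordered-suc (precedes (formWord i j w) p′ q) (precedes-position i j i≢j w p′ q (≤-pred p<) q<)
precedes-position i j i≢j (x ∷ w) p q p< q< | no _ | yes refl with q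
...   | zero   = s≤s z≤n
...   | suc q′ = Ordered-suc (precedes (formWord i j w) p q′) (precedes-position i j i≢j w p q′ p< (≤-pred q<))
precedes-position i j i≢j (x ∷ w) p q p< q< | no _ | no _ =
  Ordered-suc (precedes (formWord i j w) p q) (precedes-position i j i≢j w p q p< q<)

module _ {k : ℕ} (i j : Fin k) where

  formWord-++ : ∀ w₁ w₂ → formWord i j (w₁ ++ w₂) ≡ formWord i j w₁ ++ formWord i j w₂
  formWord-++ []       w₂ = refl
  formWord-++ (x ∷ w₁) w₂ with x ≟F i | x ≟F j
  ... | yes _ | _     = cong (A ∷_) (formWord-++ w₁ w₂)
  ... | no _  | yes _ = cong (B ∷_) (formWord-++ w₁ w₂)
  ... | no _  | no _  = formWord-++ w₁ w₂

  reverse-formWord-[_] : ∀ x → reverse (formWord i j [ x ]) ≡ formWord i j [ x ]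
  reverse-formWord-[ x ] with x ≟F i | x ≟F j
  ... | yes _ | _     = refl
  ... | no _  | yes _ = refl
  ... | no _  | no _  = refl

  reverse-formWord : ∀ w → reverse (formWord i j w) ≡ formWord i j (reverse w)
  reverse-formWord []      = refl
  reverse-formWord (x ∷ w) = begin
    reverse (formWord i j ([ x ] ++ w))                       ≡⟨ cong reverse (formWord-++ [ x ] w) ⟩
    reverse (formWord i j [ x ] ++ formWord i j w)            ≡⟨ reverse-++ (formWord i j [ x ]) _ ⟩
    reverse (formWord i j w) ++ reverse (formWord i j [ x ])  ≡⟨ cong₂ _++_ (reverse-formWord w) reverse-formWord-[ x ] ⟩
    formWord i j (reverse w) ++ formWord i j [ x ]            ≡⟨ formWord-++ (reverse w) [ x ] ⟨
    formWord i j (reverse w ++ [ x ])                         ≡⟨ cong (formWord i j) (unfold-reverse x w) ⟨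
    formWord i j (reverse (x ∷ w))                            ∎
    where open ≡-Reasoning

  formWord-flip : i ≢ j → ∀ w → formWord j i w ≡ swapAll (formWord i j w)
  formWord-flip i≢j []      = refl
  formWord-flip i≢j (x ∷ w) with x ≟F i | x ≟F j
  ... | yes refl | yes refl = ⊥-elim (i≢j refl)
  ... | yes _    | no _     = cong (B ∷_) (formWord-flip i≢j w)
  ... | no _     | yes _    = cong (A ∷_) (formWord-flip i≢j w)
  ... | no _     | no _     = formWord-flip i≢j w

form-sym : ∀ {r k} (M : Matching r k) i j → i ≢ j → form M i j ≡ form M j i
form-sym M i j i≢j =
  trans (sym (normalize-swapAll (formWord i j (word M)))) (cong normalize (sym (formWord-flip i j i≢j (word M))))

precedes-0-0-normal : ∀ z → precedes z 0 0 ≡ true → normalize z ≡ z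
precedes-0-0-normal (A ∷ z) _ = refl

module MirrorFamilyMatching {r k : ℕ} (M : Matching r k) (m : ℕ) (τ : List AB) (suc-m<r : suc m < r)
  (family : ∀ x y → x ≢ y → MirrorFamily m τ (form M x y)) where

  -- The position, counted from the right end, of the p-th vertex of x from the right (from 0).
  vertex : Fin k → ℕ → ℕ
  vertex x p = position (reverse (word M)) x p

  _◃_ : Fin k → Fin k → Set
  x ◃ y = vertex x 0 < vertex y 0

  ◃⇒≢ : ∀ {x y} → x ◃ y → x ≢ y
  ◃⇒≢ x◃y refl = <-irrefl refl x◃y

  0<r : 0 < r
  0<r = ≤-trans (s≤s z≤n) suc-m<r

  1<r : 1 < r
  1<r = ≤-trans (s≤s (s≤s z≤n)) suc-m<r

  vertex-order : ∀ x y → x ≢ y → ∀ {p q b} → p < r → q < r →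
                 precedes (formWord x y (reverse (word M))) p q ≡ b → Ordered b (vertex x p) (vertex y q)
  vertex-order x y x≢y {p} {q} p<r q<r refl =
    precedes-position x y x≢y (reverse (word M)) p q (occurrences p<r x) (occurrences q<r y)
    where
    occurrences : ∀ {p} → p < r → ∀ x → p < occ x (reverse (word M))
    occurrences p<r x = subst (_ <_) (sym (trans (length-filter-reverse (_≟F x) (word M)) (uniform M x))) p<r

  ◃-connex : ∀ x y → x ≢ y → x ◃ y ⊎ y ◃ x
  ◃-connex x y x≢y with precedes (formWord x y (reverse (word M))) 0 0 in e
  ... | true  = inj₁ (vertex-order x y x≢y 0<r 0<r e)
  ... | false = inj₂ (vertex-order x y x≢y 0<r 0<r e)

  mirror-form : ∀ x y → x ◃ y → mirror (form M x y) ≡ formWord x y (reverse (word M))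
  mirror-form x y x◃y with precedes (formWord x y (reverse (word M))) 0 0 in e
  ... | false = ⊥-elim (<-asym x◃y (vertex-order x y (◃⇒≢ x◃y) 0<r 0<r e))
  ... | true  = begin
    mirror (normalize (formWord x y (word M)))   ≡⟨ mirror-normalize (formWord x y (word M)) ⟩
    normalize (reverse (formWord x y (word M)))  ≡⟨ cong normalize (reverse-formWord x y (word M)) ⟩
    normalize (formWord x y (reverse (word M)))  ≡⟨ precedes-0-0-normal _ e ⟩
    formWord x y (reverse (word M))              ∎
    where open ≡-Reasoning

  formWord-shape : ∀ x y → x ◃ y →
                   ∃₂ λ j u → j + u ≡ m × formWord x y (reverse (word M)) ≡ shape (suc j) u τ
  formWord-shape x y x◃y with family x y (◃⇒≢ x◃y)
  ... | j , u , j+u≡m , e = j , u , j+u≡m , trans (sym (mirror-form x y x◃y)) e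

  second-before-first : ∀ x y → x ◃ y → vertex x 1 < vertex y 0
  second-before-first x y x◃y with formWord-shape x y x◃y
  ... | j , u , _ , e = vertex-order x y (◃⇒≢ x◃y) 1<r 0<r (cong (λ z → precedes z 1 0) e)

  last-before-second : ∀ x y → x ◃ y → vertex x (suc m) < vertex y 1
  last-before-second x y x◃y with formWord-shape x y x◃y
  ... | j , u , refl , e = vertex-order x y (◃⇒≢ x◃y) suc-m<r 1<r
    (trans (cong (λ z → precedes z (suc j + u) 1) e) (precedes-shape-last (suc j) u τ))

  -- For members of the family: the mirror has an A between its first two B's.
  Gapped : List AB → Set
  Gapped W = mirror W ≢ shape (suc m) 0 τ

  straddles : ∀ x y → x ◃ y → Gapped (form M x y) → vertex y 0 < vertex x (suc m)
  straddles x y x◃y gap with formWord-shape x y x◃y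
  ... | j , zero , refl , e =
    ⊥-elim (gap (trans (mirror-form x y x◃y) (trans e (cong (λ n → shape (suc n) 0 τ) (sym (+-identityʳ j))))))
  ... | j , suc u , refl , e = vertex-order x y (◃⇒≢ x◃y) suc-m<r 0<r
    (trans (cong (λ z → precedes z (suc j + suc u) 0) e) (precedes-shape-gap (suc j) u τ))

  first-gaps-disjoint : ∀ y z → y ≢ z → ∀ {v} → vertex y 0 < v → v < vertex y 1 → vertex z 0 < v → v < vertex z 1 → ⊥
  first-gaps-disjoint y z y≢z y₀<v v<y₁ z₀<v v<z₁ with ◃-connex y z y≢z
  ... | inj₁ y◃z = <-irrefl refl (<-trans z₀<v (<-trans v<y₁ (second-before-first y z y◃z)))
  ... | inj₂ z◃y = <-irrefl refl (<-trans y₀<v (<-trans v<z₁ (second-before-first z y z◃y)))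

  gapped-successor-unique : ∀ x y z → x ◃ y → x ◃ z → Gapped (form M x y) → Gapped (form M x z) → y ≡ z
  gapped-successor-unique x y z x◃y x◃z gy gz with y ≟F z
  ... | yes y≡z = y≡z
  ... | no y≢z  = ⊥-elim (first-gaps-disjoint y z y≢z
                    (straddles x y x◃y gy) (last-before-second x y x◃y) (straddles x z x◃z gz) (last-before-second x z x◃z))

  ◃-least-of-three : ∀ x y z → x ≢ y → x ≢ z → y ≢ z → ∃ λ a → ∃₂ λ b c → b ≢ c × a ◃ b × a ◃ c
  ◃-least-of-three x y z x≢y x≢z y≢z with ◃-connex x y x≢y | ◃-connex x z x≢z | ◃-connex y z y≢z
  ... | inj₁ x◃y | inj₁ x◃z | _        = x , y , z , y≢z , x◃y , x◃z
  ... | inj₁ x◃y | inj₂ z◃x | _        = z , x , y , x≢y , z◃x , <-trans z◃x x◃y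
  ... | inj₂ y◃x | _        | inj₁ y◃z = y , x , z , x≢z , y◃x , y◃z
  ... | inj₂ y◃x | _        | inj₂ z◃y = z , x , y , x≢y , <-trans z◃y y◃x , z◃y

  no-gapped-triangle : (∀ x y → x ≢ y → Gapped (form M x y)) → ∀ x y z → x ≢ y → x ≢ z → y ≢ z → ⊥
  no-gapped-triangle gapped x y z x≢y x≢z y≢z with ◃-least-of-three x y z x≢y x≢z y≢z
  ... | a , b , c , b≢c , a◃b , a◃c =
    b≢c (gapped-successor-unique a b c a◃b a◃c (gapped a b (◃⇒≢ a◃b)) (gapped a c (◃⇒≢ a◃c)))

Fin-bounded : ∀ {k} (f : Fin k → ℕ) → ∃ λ b → ∀ x → f x < b
Fin-bounded {zero}  f = 0 , λ ()
Fin-bounded {suc k} f with Fin-bounded (f ∘′ suc)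
... | b , f∘suc<b = suc (f zero) ⊔ b , λ where
  zero    → m≤m⊔n (suc (f zero)) b
  (suc x) → ≤-trans (f∘suc<b x) (m≤n⊔m (suc (f zero)) b)

-- Colour in order of decreasing rank: a vertex then only has to differ from its unique
-- neighbour of larger rank, which is already coloured.
module ForwardUniqueColouring {k : ℕ} (_~_ : Fin k → Fin k → Set) (_~?_ : ∀ x y → Dec (x ~ y))
  (~-sym : ∀ {x y} → x ~ y → y ~ x) (~-irrefl : ∀ {x} → ¬ x ~ x)
  (rank : Fin k → ℕ) (rank-injective : ∀ {x y} → rank x ≡ rank y → x ≡ y)
  (forward-unique : ∀ {x y z} → x ~ y → x ~ z → rank x < rank y → rank x < rank z → y ≡ z) where

  ProperAbove : ℕ → (Fin k → Bool) → Set
  ProperAbove N c = ∀ {x y} → N ≤ rank x → N ≤ rank y → x ~ y → c x ≢ c y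

  forward? : ∀ x → Dec (∃ λ y → x ~ y × rank x < rank y)
  forward? x = any? λ y → (x ~? y) ×-dec (rank x <? rank y)

  recolour : ℕ → (Fin k → Bool) → Fin k → Bool
  recolour N c x with rank x ≟ N | forward? x
  ... | yes _ | yes (y , _) = not (c y)
  ... | yes _ | no _        = c x
  ... | no _  | _           = c x

  recolour-other : ∀ N c x → rank x ≢ N → recolour N c x ≡ c x
  recolour-other N c x x≢N with rank x ≟ N | forward? x
  ... | yes x≡N | _ = ⊥-elim (x≢N x≡N)
  ... | no _    | _ = refl

  recolour-forward : ∀ N c {x y} → rank x ≡ N → x ~ y → rank x < rank y → recolour N c x ≡ not (c y)
  recolour-forward N c {x} {y} x≡N x~y x<y with rank x ≟ N | forward? x
  ... | no x≢N | _                      = ⊥-elim (x≢N x≡N)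
  ... | yes _  | no none                = ⊥-elim (none (y , x~y , x<y))
  ... | yes _  | yes (y′ , x~y′ , x<y′) = cong (not ∘′ c) (forward-unique x~y′ x~y x<y′ x<y)

  recolour-proper : ∀ N c → ProperAbove (suc N) c → ProperAbove N (recolour N c)
  recolour-proper N c proper {x} {y} N≤x N≤y x~y = split (rank x ≟ N) (rank y ≟ N)
    where
    new-vs-old : ∀ {x y} → rank x ≡ N → rank y ≢ N → N ≤ rank y → x ~ y → recolour N c x ≢ recolour N c y
    new-vs-old {x} {y} x≡N y≢N N≤y x~y e = not-¬ refl (begin
      c y                ≡⟨ recolour-other N c y y≢N ⟨
      recolour N c y     ≡⟨ e ⟨
      recolour N c x     ≡⟨ recolour-forward N c x≡N x~y (subst (_< rank y) (sym x≡N) (≤∧≢⇒< N≤y (y≢N ∘′ sym))) ⟩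
      not (c y)          ∎)
      where open ≡-Reasoning
    split : Dec (rank x ≡ N) → Dec (rank y ≡ N) → recolour N c x ≢ recolour N c y
    split (yes x≡N) (yes y≡N) _ = ~-irrefl (subst (_~ y) (rank-injective (trans x≡N (sym y≡N))) x~y)
    split (yes x≡N) (no y≢N)    = new-vs-old x≡N y≢N N≤y x~y
    split (no x≢N)  (yes y≡N)   = new-vs-old y≡N x≢N N≤x (~-sym x~y) ∘′ sym
    split (no x≢N)  (no y≢N) e  = proper (≤∧≢⇒< N≤x (x≢N ∘′ sym)) (≤∧≢⇒< N≤y (y≢N ∘′ sym)) x~y
      (trans (sym (recolour-other N c x x≢N)) (trans e (recolour-other N c y y≢N)))

  colouring-above : ∀ n N → (∀ x → rank x < N + n) → Σ (Fin k → Bool) (ProperAbove N)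
  colouring-above zero    N below = (λ _ → true) , λ {x} N≤x _ _ _ →
    <-irrefl refl (<-≤-trans (below x) (subst (_≤ rank x) (sym (+-identityʳ N)) N≤x))
  colouring-above (suc n) N below with colouring-above n (suc N) (λ x → subst (rank x <_) (+-suc N n) (below x))
  ... | c , proper = recolour N c , recolour-proper N c proper

  two-colouring : Σ (Fin k → Bool) λ c → ∀ {x y} → x ~ y → c x ≢ c y
  two-colouring with Fin-bounded rank
  ... | b , below with colouring-above b 0 below
  ...   | c , proper = c , proper z≤n z≤n

∈-tabulate : ∀ {k} (f : Fin k → Bool) {i} → i ∈ tabulate f → f i ≡ true
∈-tabulate f {i} i∈ = trans (sym (lookup∘tabulate f i)) ([]=⇒lookup i∈)

∈-∁-tabulate : ∀ {k} (f : Fin k → Bool) {i} → i ∈ ∁ (tabulate f) → not (f i) ≡ true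
∈-∁-tabulate f i∈ = ∈-tabulate (not ∘′ f) (subst (_ ∈_) (sym (tabulate-∘ not f)) i∈)

larger-half : ∀ a b {k} → a + b ≡ k → k ≤ 2 * a ⊎ k ≤ 2 * b
larger-half a b refl with ≤-total a b
... | inj₁ a≤b = inj₂ (subst (a + b ≤_) (cong (b +_) (sym (+-identityʳ b))) (+-monoˡ-≤ b a≤b))
... | inj₂ b≤a = inj₁ (subst (a + b ≤_) (cong (a +_) (sym (+-identityʳ a))) (+-monoʳ-≤ a b≤a))

∣p∣+∣∁p∣≡n : ∀ {n} (p : Subset n) → ∣ p ∣ + ∣ ∁ p ∣ ≡ n
∣p∣+∣∁p∣≡n p = trans (cong (∣ p ∣ +_) (∣∁p∣≡n∸∣p∣ p)) (m+[n∸m]≡n (∣p∣≤n p))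

large-monochromatic-class : ∀ {k} (c : Fin k → Bool) →
                            Σ (Subset k) λ S → k ≤ 2 * ∣ S ∣ × (∀ {i j} → i ∈ S → j ∈ S → c i ≡ c j)
large-monochromatic-class c with larger-half ∣ tabulate c ∣ ∣ ∁ (tabulate c) ∣ (∣p∣+∣∁p∣≡n (tabulate c))
... | inj₁ large = tabulate c , large , λ i∈ j∈ → trans (∈-tabulate c i∈) (sym (∈-tabulate c j∈))
... | inj₂ large = ∁ (tabulate c) , large , λ i∈ j∈ → not-injective (trans (∈-∁-tabulate c i∈) (sym (∈-∁-tabulate c j∈)))

last-index<r : ∀ {r P j u τ} → IsPattern r P → mirror P ≡ shape (suc j) u τ → suc (j + u) < r
last-index<r {r} {P} {j} {u} {τ} pat e = begin-strict
  suc (j + u)                          <⟨ s≤s (s≤s (+-monoʳ-≤ j (m≤m+n u (countAB A τ)))) ⟩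
  suc (suc j + (u + countAB A τ))      ≡⟨ countAB-A-shape (suc j) u τ ⟨
  countAB A (shape (suc j) u τ)        ≡⟨ cong (countAB A) e ⟨
  countAB A (mirror P)                 ≡⟨ countAB-mirror pat A ⟩
  r                                    ∎
  where open ≤-Reasoning

collectable-gapless : ∀ {r P j u τ} → IsPattern r P → mirror P ≡ shape (suc j) u τ → Collectable r P →
                      mirror P ≡ shape (suc (j + u)) 0 τ
collectable-gapless {r} {P} {j} {u} {τ} pat e collectable with collectable 3 (s≤s (s≤s z≤n))
... | M , clique with ≡-dec _≟AB_ (mirror P) (shape (suc (j + u)) 0 τ)
...   | yes gapless = gapless
...   | no gapped   = ⊥-elim (no-gapped-triangle (λ x y x≢y → subst Gapped (sym (clique x y x≢y)) gapped)
                        zero (suc zero) (suc (suc zero)) (λ ()) (λ ()) (λ ()))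
  where
  open MirrorFamilyMatching M (j + u) τ (last-index<r pat e)
         (λ x y x≢y → subst (MirrorFamily (j + u) τ) (sym (clique x y x≢y)) (j , u , refl , e))

half-clique : ∀ {r P j u τ k} → IsPattern r P → mirror P ≡ shape (suc j) u τ → mirror P ≡ shape (suc (j + u)) 0 τ →
              (M : Matching r k) → IsFamilyClique P M → Σ (Subset k) λ S → k ≤ 2 * ∣ S ∣ × IsCliqueOn P M S
half-clique {r} {P} {j} {u} {τ} {k} pat e gapless M fam = colour-class two-colouring
  where
  2≤r : 2 ≤ r
  2≤r = ≤-trans (s≤s (s≤s z≤n)) (last-index<r pat e)

  open MirrorFamilyMatching M (j + u) τ (last-index<r pat e) (λ x y x≢y → family-mirror-shape {P = P} 2≤r e (fam x y x≢y))

  Bad : Fin k → Fin k → Set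
  Bad x y = x ≢ y × form M x y ≢ P

  bad-gapped : ∀ {x y} → Bad x y → Gapped (form M x y)
  bad-gapped {x} {y} (x≢y , x≁y) gap =
    x≁y (mirror-injective-on-patterns (proj₁ (fam x y x≢y)) pat (trans gap (sym gapless)))

  rank-injective : ∀ {x y} → vertex x 0 ≡ vertex y 0 → x ≡ y
  rank-injective {x} {y} same with x ≟F y
  ... | yes x≡y = x≡y
  ... | no x≢y with ◃-connex x y x≢y
  ...   | inj₁ x◃y = ⊥-elim (<-irrefl same x◃y)
  ...   | inj₂ y◃x = ⊥-elim (<-irrefl (sym same) y◃x)

  open ForwardUniqueColouring Bad
    (λ x y → ¬? (x ≟F y) ×-dec ¬? (≡-dec _≟AB_ (form M x y) P))
    (λ {x} {y} (x≢y , x≁y) → x≢y ∘′ sym , x≁y ∘′ trans (form-sym M x y x≢y))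
    (λ (x≢x , _) → x≢x refl)
    (λ x → vertex x 0) rank-injective
    (λ {x} {y} {z} x~y x~z x◃y x◃z → gapped-successor-unique x y z x◃y x◃z (bad-gapped x~y) (bad-gapped x~z))

  colour-class : Σ (Fin k → Bool) (λ c → ∀ {x y} → Bad x y → c x ≢ c y) →
                 Σ (Subset k) λ S → k ≤ 2 * ∣ S ∣ × IsCliqueOn P M S
  colour-class (c , proper) with large-monochromatic-class c
  ... | S , large , mono = S , large , λ x y x∈ y∈ x≢y →
    decidable-stable (≡-dec _≟AB_ (form M x y) P) (λ x≁y → proper (x≢y , x≁y) (mono x∈ y∈))

proposition2p4 : (r : ℕ) → 3 ≤ r → (P : List AB) → BigBrother r P →
    (k : ℕ) (M : Matching r k) → IsFamilyClique P M →
    Σ (Subset k) (λ S → k ≤ 2 * ∣ S ∣ × IsCliqueOn P M S)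
proposition2p4 r 3≤r P bb k M fam with bigBrother-mirror-shape (≤-trans (s≤s (s≤s z≤n)) 3≤r) bb
... | j , u , τ , e = half-clique pat e (collectable-gapless pat e (BigBrother.collectable bb)) M fam
  where pat = BigBrother.isPattern bb
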